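{- Consider any execution of Algorithm A (described in the context). For each edge $e=\{u,v\}\in E$ that is added to the stack $S$, letting $\mathcal{P}(e)=\{e'\in E: e'\cap e\neq\emptyset,\ e' \text{ inspected no later than } e\}$ (which includes $e$ itself), we have $$w_e\ \ge\ \frac12\sum_{e'\in\mathcal{P}(e)}\Delta\phi^{e'}\ =\ \sum_{e'\in\mathcal{P}(e)}w'_{e'}.$$
   Context: $G=(V,E,w)$ is a simple graph with positive edge weights, whose edges arrive in a stream in arbitrary order; "inspected" refers to the order in which edges are processed. Algorithm A with parameter $\varepsilon\ge 0$: initialize an empty stack $S$ and $\phi_v=0$ for every vertex $v$. For each edge $e=\{u,v\}$ in stream order: if $w_e<(1+\varepsilon)(\phi_u+\phi_v)$, skip $e$; otherwise set $w'_e=w_e-(\phi_u+\phi_v)$, then $\phi_u\leftarrow\phi_u+w'_e$, $\phi_v\leftarrow\phi_v+w'_e$, and push $e$ onto $S$. (Afterwards edges are popped from $S$ and greedily added to a matching.) For an edge $e$, $\Delta\phi^e$ denotes the change in $\sum_{v\in V}\phi_v$ caused by the updates of $\phi_u,\phi_v$ during the inspection of $e$ (so $\Delta\phi^e=0$ if $e$ is skipped), and $w'_e:=0$ for skipped edges.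
   Formalization: The edge weights and the parameter ε take rational values, so the potentials φ_v and the quantities $w'_e$ and $\Delta\phi^e$ are rational as well. -}

module Defs where

open import Data.Nat using (ℕ)
open import Data.Fin using (Fin; _≟_; _≤_; toℕ)
open import Data.Fin.Properties using (_≤?_)
open import Data.List using (List; []; _∷_; length; lookup; take; foldl; map; foldr; allFin)
open import Data.Rational as Q using (ℚ; 0ℚ; 1ℚ; _+_; _-_; _*_)
import Data.Rational.Properties as QP
open import Data.Product using (_×_; _,_)
open import Relation.Binary.PropositionalEquality using (_≡_; _≢_)
open import Relation.Nullary using (Dec; yes; no; ¬_)
open import Data.Sum using (_⊎_)
open import Relation.Nullary.Decidable using (_×-dec_; _⊎-dec_)

record Edge (n : ℕ) : Set where
  constructor edge
  field
    u : Fin n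
    v : Fin n
    w : ℚ
open Edge public

Pot : ℕ → Set
Pot n = Fin n → ℚ

sumFin : ∀ {n} → (Fin n → ℚ) → ℚ
sumFin {n} f = foldr (λ i acc → f i + acc) 0ℚ (allFin n)

totalPot : ∀ {n} → Pot n → ℚ
totalPot φ = sumFin φ

bump : ∀ {n} → Fin n → ℚ → Pot n → Pot n
bump a x φ b with a ≟ b
... | yes _ = φ b + x
... | no  _ = φ b

-- The test of Algorithm A: e is pushed iff not (w_e < (1+ε)(φ_u+φ_v)),
-- i.e. iff (1+ε)(φ_u+φ_v) ≤ w_e.
pushTest : ∀ {n} → ℚ → Pot n → Edge n → Set
pushTest ε φ e = ((1ℚ + ε) * (φ (u e) + φ (v e))) Q.≤ w e

wPrime : ∀ {n} → ℚ → Pot n → Edge n → ℚ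
wPrime ε φ e with ((1ℚ + ε) * (φ (u e) + φ (v e))) QP.≤? w e
... | yes _ = w e - (φ (u e) + φ (v e))
... | no  _ = 0ℚ

step : ∀ {n} → ℚ → Pot n → Edge n → Pot n
step ε φ e with ((1ℚ + ε) * (φ (u e) + φ (v e))) QP.≤? w e
... | yes _ = let x = w e - (φ (u e) + φ (v e)) in bump (v e) x (bump (u e) x φ)
... | no  _ = φ

Meets : ∀ {n} → Edge n → Edge n → Set
Meets e' e = (u e' ≡ u e ⊎ u e' ≡ v e) ⊎ (v e' ≡ u e ⊎ v e' ≡ v e)

meets? : ∀ {n} (e' e : Edge n) → Dec (Meets e' e)
meets? e' e = ((u e' ≟ u e) ⊎-dec (u e' ≟ v e)) ⊎-dec ((v e' ≟ u e) ⊎-dec (v e' ≟ v e))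

if⌊_⌋ : ∀ {P : Set} → Dec P → ℚ → ℚ
if⌊ yes _ ⌋ x = x
if⌊ no  _ ⌋ _ = 0ℚ

φ₀ : ∀ {n} → Pot n
φ₀ _ = 0ℚ

module Run {n : ℕ} (ε : ℚ) (es : List (Edge n)) where
  Idx : Set
  Idx = Fin (length es)

  edgeAt : Idx → Edge n
  edgeAt i = lookup es i

  φBefore : Idx → Pot n
  φBefore i = foldl (step ε) φ₀ (take (toℕ i) es)

  φAfter : Idx → Pot n
  φAfter i = step ε (φBefore i) (edgeAt i)

  Pushed : Idx → Set
  Pushed i = pushTest ε (φBefore i) (edgeAt i)

  w′ : Idx → ℚ
  w′ i = wPrime ε (φBefore i) (edgeAt i)

  Δφ : Idx → ℚ
  Δφ i = totalPot (φAfter i) - totalPot (φBefore i)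

  InP : Idx → Idx → Set
  InP i j = (j ≤ i) × Meets (edgeAt j) (edgeAt i)

  inP? : (i j : Idx) → Dec (InP i j)
  inP? i j = (j ≤? i) ×-dec meets? (edgeAt j) (edgeAt i)

  sumP : Idx → (Idx → ℚ) → ℚ
  sumP i f = sumFin (λ j → if⌊ inP? i j ⌋ (f j))

-- The stream enumerates the edges of a simple graph with positive weights:
-- no loops, positive weights, and no unordered pair appears twice.
record SimpleStream {n : ℕ} (es : List (Edge n)) : Set where
  field
    noLoop   : ∀ i → u (lookup es i) ≢ v (lookup es i)
    posW     : ∀ i → 0ℚ Q.< w (lookup es i)
    distinct : ∀ i j → i ≢ j →
               ¬ ((u (lookup es i) ≡ u (lookup es j) × v (lookup es i) ≡ v (lookup es j))
                  ⊎ (u (lookup es i) ≡ v (lookup es j) × v (lookup es i) ≡ u (lookup es j)))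

{-# OPTIONS --safe #-}

-- Because the graph is simple, an edge e′ inspected before e = {u,v} that meets e
-- shares exactly one endpoint with it, so its w′ was added to exactly one of φ_u, φ_v.
-- Hence φ_u + φ_v just before e is inspected is the sum of w′ over the earlier edges
-- of P(e), and adding w′_e = w_e − (φ_u + φ_v) gives exactly w_e.  Every inspected
-- edge raises two potentials by its w′, so Δφ = 2w′; both claims thus hold with equality.

module Submission where

open import Defs
open import Data.List using (List; length; take; foldl; foldr; tabulate)
open import Data.List.Properties using (take-suc; foldl-∷ʳ)
open import Data.Nat using (ℕ; zero; suc; s≤s; s≤s⁻¹) renaming (_≤_ to _≤ℕ_; _<_ to _<ℕ_)
open import Data.Nat.Properties using (_<?_; <⇒≤; ≤-refl; <-irrefl; <-trans; m<n⇒m<1+n; m<1+n⇒m<n∨m≡n)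
open import Data.Fin using (Fin; zero; suc; toℕ; fromℕ<; _≟_)
open import Data.Fin.Properties using (suc-injective; toℕ-injective; toℕ-fromℕ<; toℕ<n; _≤?_)
open import Data.Rational using (ℚ; 0ℚ; 1ℚ; ½; _*_; _≤_; _+_; _-_)
open import Data.Rational.Properties as QP using (+-0-commutativeMonoid)
open import Algebra.Properties.CommutativeMonoid.Sum +-0-commutativeMonoid
  using (sum; sum-syntax; sum-cong-≗; ∑-distrib-+; sum-replicate-zero)
open import Data.Rational.Solver using (module +-*-Solver)
open +-*-Solver using (solve; _:+_; _:-_; _:*_; _:=_; con)
open import Data.Product using (_×_; _,_)
open import Data.Sum using (_⊎_; inj₁; inj₂)
open import Data.Empty using (⊥-elim)
open import Relation.Nullary using (Dec; yes; no; ¬_)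
open import Relation.Nullary.Decidable using (_×-dec_; _⊎-dec_)
open import Relation.Binary.PropositionalEquality
  using (_≡_; _≢_; refl; sym; trans; cong; cong₂; module ≡-Reasoning)

if-yes : ∀ {P : Set} (p? : Dec P) (x : ℚ) → P → if⌊ p? ⌋ x ≡ x
if-yes (yes _) x _ = refl
if-yes (no ¬p) x p = ⊥-elim (¬p p)

if-⇔ : ∀ {P Q : Set} (p? : Dec P) (q? : Dec Q) (x : ℚ) → (P → Q) → (Q → P) →
       if⌊ p? ⌋ x ≡ if⌊ q? ⌋ x
if-⇔ (yes _) (yes _) x _   _   = refl
if-⇔ (no _)  (no _)  x _   _   = refl
if-⇔ (yes p) (no ¬q) x p⇒q _   = ⊥-elim (¬q (p⇒q p))
if-⇔ (no ¬p) (yes q) x _   q⇒p = ⊥-elim (¬p (q⇒p q))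

if-× : ∀ {P Q : Set} (p? : Dec P) (q? : Dec Q) (x : ℚ) →
       if⌊ p? ×-dec q? ⌋ x ≡ if⌊ p? ⌋ (if⌊ q? ⌋ x)
if-× (yes _) (yes _) x = refl
if-× (yes _) (no _)  x = refl
if-× (no _)  _       x = refl

if-⊎ : ∀ {P Q : Set} (p? : Dec P) (q? : Dec Q) (x : ℚ) → ¬ (P × Q) →
       if⌊ p? ⊎-dec q? ⌋ x ≡ if⌊ p? ⌋ x + if⌊ q? ⌋ x
if-⊎ (yes p) (yes q) x ¬pq = ⊥-elim (¬pq (p , q))
if-⊎ (yes _) (no _)  x _   = sym (QP.+-identityʳ x)
if-⊎ (no _)  (yes _) x _   = sym (QP.+-identityˡ x)
if-⊎ (no _)  (no _)  x _   = sym (QP.+-identityʳ 0ℚ)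

if-zero : ∀ {P : Set} (p? : Dec P) → if⌊ p? ⌋ 0ℚ ≡ 0ℚ
if-zero (yes _) = refl
if-zero (no _)  = refl

if-+ : ∀ {P : Set} (p? : Dec P) (x y : ℚ) → if⌊ p? ⌋ (x + y) ≡ if⌊ p? ⌋ x + if⌊ p? ⌋ y
if-+ (yes _) x y = refl
if-+ (no _)  x y = sym (QP.+-identityʳ 0ℚ)

sumFin≡sum : ∀ {m} (f : Fin m → ℚ) → sumFin f ≡ sum f
sumFin≡sum {m} f = foldr-tabulate (λ j → j)
  where
  foldr-tabulate : ∀ {k} (g : Fin k → Fin m) →
                   foldr (λ j acc → f j + acc) 0ℚ (tabulate g) ≡ ∑[ j < k ] f (g j)
  foldr-tabulate {zero}  g = refl
  foldr-tabulate {suc k} g = cong (f (g zero) +_) (foldr-tabulate (λ j → g (suc j)))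

∑-indicator : ∀ {m} (k : Fin m) (f : Fin m → ℚ) → ∑[ j < m ] if⌊ k ≟ j ⌋ (f j) ≡ f k
∑-indicator {suc m} zero    f = trans (cong (f zero +_) (sum-replicate-zero m)) (QP.+-identityʳ (f zero))
∑-indicator {suc m} (suc k) f = begin
  ∑[ j < suc m ] if⌊ suc k ≟ j ⌋ (f j)
    ≡⟨ QP.+-identityˡ _ ⟩
  ∑[ j < m ] if⌊ suc k ≟ suc j ⌋ (f (suc j))
    ≡⟨ sum-cong-≗ (λ j → if-⇔ (suc k ≟ suc j) (k ≟ j) (f (suc j)) suc-injective (cong suc)) ⟩
  ∑[ j < m ] if⌊ k ≟ j ⌋ (f (suc j))
    ≡⟨ ∑-indicator k (λ j → f (suc j)) ⟩
  f (suc k)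
    ∎
  where open ≡-Reasoning

sumBelow : ∀ {m} → ℕ → (Fin m → ℚ) → ℚ
sumBelow {m} k f = ∑[ j < m ] if⌊ toℕ j <? k ⌋ (f j)

sumBelow-zero : ∀ {m} (f : Fin m → ℚ) → sumBelow 0 f ≡ 0ℚ
sumBelow-zero {m} f = sum-replicate-zero m

sumBelow-suc : ∀ {m} (f : Fin m → ℚ) (k : Fin m) → sumBelow (suc (toℕ k)) f ≡ sumBelow (toℕ k) f + f k
sumBelow-suc {m} f k = begin
  sumBelow (suc (toℕ k)) f
    ≡⟨ sum-cong-≗ split ⟩
  ∑[ j < m ] (if⌊ toℕ j <? toℕ k ⌋ (f j) + if⌊ k ≟ j ⌋ (f j))
    ≡⟨ ∑-distrib-+ (λ j → if⌊ toℕ j <? toℕ k ⌋ (f j)) (λ j → if⌊ k ≟ j ⌋ (f j)) ⟩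
  sumBelow (toℕ k) f + ∑[ j < m ] if⌊ k ≟ j ⌋ (f j)
    ≡⟨ cong (sumBelow (toℕ k) f +_) (∑-indicator k f) ⟩
  sumBelow (toℕ k) f + f k
    ∎
  where
  open ≡-Reasoning
  split : ∀ j → if⌊ toℕ j <? suc (toℕ k) ⌋ (f j) ≡
                if⌊ toℕ j <? toℕ k ⌋ (f j) + if⌊ k ≟ j ⌋ (f j)
  split j = trans (if-⇔ (toℕ j <? suc (toℕ k)) (toℕ j <? toℕ k ⊎-dec k ≟ j) (f j) below below⁻¹)
                  (if-⊎ (toℕ j <? toℕ k) (k ≟ j) (f j) (λ (j<k , k≡j) → <-irrefl (cong toℕ (sym k≡j)) j<k))
    where
    below : toℕ j <ℕ suc (toℕ k) → toℕ j <ℕ toℕ k ⊎ k ≡ j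
    below j<1+k with m<1+n⇒m<n∨m≡n j<1+k
    ... | inj₁ j<k = inj₁ j<k
    ... | inj₂ j≡k = inj₂ (toℕ-injective (sym j≡k))
    below⁻¹ : toℕ j <ℕ toℕ k ⊎ k ≡ j → toℕ j <ℕ suc (toℕ k)
    below⁻¹ (inj₁ j<k) = m<n⇒m<1+n j<k
    below⁻¹ (inj₂ refl) = ≤-refl

bump-apply : ∀ {n} (a : Fin n) (x : ℚ) (φ : Pot n) (b : Fin n) → bump a x φ b ≡ φ b + if⌊ a ≟ b ⌋ x
bump-apply a x φ b with a ≟ b
... | yes _ = refl
... | no _  = sym (QP.+-identityʳ (φ b))

step-apply : ∀ {n} (ε : ℚ) (φ : Pot n) (e : Edge n) (b : Fin n) →
             let x = wPrime ε φ e in step ε φ e b ≡ (φ b + if⌊ u e ≟ b ⌋ x) + if⌊ v e ≟ b ⌋ x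
step-apply ε φ e b with (1ℚ + ε) * (φ (u e) + φ (v e)) QP.≤? w e
... | yes _ = trans (bump-apply (v e) x (bump (u e) x φ) b) (cong (_+ if⌊ v e ≟ b ⌋ x) (bump-apply (u e) x φ b))
  where x = w e - (φ (u e) + φ (v e))
... | no _  = sym (begin
  (φ b + if⌊ u e ≟ b ⌋ 0ℚ) + if⌊ v e ≟ b ⌋ 0ℚ
    ≡⟨ cong₂ (λ p q → (φ b + p) + q) (if-zero (u e ≟ b)) (if-zero (v e ≟ b)) ⟩
  (φ b + 0ℚ) + 0ℚ
    ≡⟨ trans (QP.+-identityʳ _) (QP.+-identityʳ _) ⟩
  φ b
    ∎)
  where open ≡-Reasoning

wPrime-pushed : ∀ {n} (ε : ℚ) (φ : Pot n) (e : Edge n) → pushTest ε φ e →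
                wPrime ε φ e ≡ w e - (φ (u e) + φ (v e))
wPrime-pushed ε φ e pushed with (1ℚ + ε) * (φ (u e) + φ (v e)) QP.≤? w e
... | yes _      = refl
... | no skipped = ⊥-elim (skipped pushed)

totalPot-step : ∀ {n} (ε : ℚ) (φ : Pot n) (e : Edge n) →
                let x = wPrime ε φ e in totalPot (step ε φ e) ≡ totalPot φ + (x + x)
totalPot-step {n} ε φ e = begin
  totalPot (step ε φ e)
    ≡⟨ trans (sumFin≡sum (step ε φ e)) (sum-cong-≗ (step-apply ε φ e)) ⟩
  ∑[ b < n ] ((φ b + if⌊ u e ≟ b ⌋ x) + if⌊ v e ≟ b ⌋ x)
    ≡⟨ ∑-distrib-+ (λ b → φ b + if⌊ u e ≟ b ⌋ x) (λ b → if⌊ v e ≟ b ⌋ x) ⟩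
  ∑[ b < n ] (φ b + if⌊ u e ≟ b ⌋ x) + ∑[ b < n ] if⌊ v e ≟ b ⌋ x
    ≡⟨ cong (_+ ∑[ b < n ] if⌊ v e ≟ b ⌋ x) (∑-distrib-+ φ (λ b → if⌊ u e ≟ b ⌋ x)) ⟩
  (sum φ + ∑[ b < n ] if⌊ u e ≟ b ⌋ x) + ∑[ b < n ] if⌊ v e ≟ b ⌋ x
    ≡⟨ cong₂ (λ p q → (sum φ + p) + q) (∑-indicator (u e) (λ _ → x)) (∑-indicator (v e) (λ _ → x)) ⟩
  (sum φ + x) + x
    ≡⟨ trans (QP.+-assoc (sum φ) x x) (cong (_+ (x + x)) (sym (sumFin≡sum φ))) ⟩
  totalPot φ + (x + x)
    ∎
  where
  open ≡-Reasoning
  x = wPrime ε φ e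

Parallel : ∀ {n} → Edge n → Edge n → Set
Parallel e′ e = (u e′ ≡ u e × v e′ ≡ v e) ⊎ (u e′ ≡ v e × v e′ ≡ u e)

-- Distinct loopless edges share at most one endpoint, so at most one of the four
-- endpoint coincidences holds.
if-meets : ∀ {n} (e′ e : Edge n) (x : ℚ) → u e′ ≢ v e′ → u e ≢ v e → ¬ Parallel e′ e →
           if⌊ meets? e′ e ⌋ x ≡
           (if⌊ u e′ ≟ u e ⌋ x + if⌊ u e′ ≟ v e ⌋ x) + (if⌊ v e′ ≟ u e ⌋ x + if⌊ v e′ ≟ v e ⌋ x)
if-meets e′ e x e′-loopless e-loopless e′∦e = begin
  if⌊ meets? e′ e ⌋ x
    ≡⟨ if-⊎ (u e′ ≟ u e ⊎-dec u e′ ≟ v e) (v e′ ≟ u e ⊎-dec v e′ ≟ v e) x one-shared-endpoint ⟩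
  if⌊ u e′ ≟ u e ⊎-dec u e′ ≟ v e ⌋ x + if⌊ v e′ ≟ u e ⊎-dec v e′ ≟ v e ⌋ x
    ≡⟨ cong₂ _+_ (if-⊎ (u e′ ≟ u e) (u e′ ≟ v e) x (ends-differ (u e′)))
                 (if-⊎ (v e′ ≟ u e) (v e′ ≟ v e) x (ends-differ (v e′))) ⟩
  (if⌊ u e′ ≟ u e ⌋ x + if⌊ u e′ ≟ v e ⌋ x) + (if⌊ v e′ ≟ u e ⌋ x + if⌊ v e′ ≟ v e ⌋ x)
    ∎
  where
  open ≡-Reasoning
  ends-differ : ∀ a → ¬ (a ≡ u e × a ≡ v e)
  ends-differ a (a≡u , a≡v) = e-loopless (trans (sym a≡u) a≡v)
  one-shared-endpoint : ¬ ((u e′ ≡ u e ⊎ u e′ ≡ v e) × (v e′ ≡ u e ⊎ v e′ ≡ v e))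
  one-shared-endpoint (inj₁ p , inj₁ q) = e′-loopless (trans p (sym q))
  one-shared-endpoint (inj₁ p , inj₂ q) = e′∦e (inj₁ (p , q))
  one-shared-endpoint (inj₂ p , inj₁ q) = e′∦e (inj₂ (p , q))
  one-shared-endpoint (inj₂ p , inj₂ q) = e′-loopless (trans p (sym q))

step-endpoints : ∀ {n} (ε : ℚ) (φ : Pot n) (e′ e : Edge n) →
                 u e′ ≢ v e′ → u e ≢ v e → ¬ Parallel e′ e →
                 step ε φ e′ (u e) + step ε φ e′ (v e) ≡
                 (φ (u e) + φ (v e)) + if⌊ meets? e′ e ⌋ (wPrime ε φ e′)
step-endpoints ε φ e′ e e′-loopless e-loopless e′∦e = begin
  step ε φ e′ (u e) + step ε φ e′ (v e)
    ≡⟨ cong₂ _+_ (step-apply ε φ e′ (u e)) (step-apply ε φ e′ (v e)) ⟩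
  ((φ (u e) + uu) + vu) + ((φ (v e) + uv) + vv)
    ≡⟨ solve 6 (λ a b c d e f → ((a :+ c) :+ d) :+ ((b :+ e) :+ f) := (a :+ b) :+ ((c :+ e) :+ (d :+ f)))
             refl (φ (u e)) (φ (v e)) uu vu uv vv ⟩
  (φ (u e) + φ (v e)) + ((uu + uv) + (vu + vv))
    ≡⟨ cong (φ (u e) + φ (v e) +_) (if-meets e′ e x e′-loopless e-loopless e′∦e) ⟨
  (φ (u e) + φ (v e)) + if⌊ meets? e′ e ⌋ x
    ∎
  where
  open ≡-Reasoning
  x  = wPrime ε φ e′
  uu = if⌊ u e′ ≟ u e ⌋ x
  uv = if⌊ u e′ ≟ v e ⌋ x
  vu = if⌊ v e′ ≟ u e ⌋ x
  vv = if⌊ v e′ ≟ v e ⌋ x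

module _ {n : ℕ} (ε : ℚ) (es : List (Edge n)) where
  open Run ε es

  prefix : ℕ → Pot n
  prefix k = foldl (step ε) φ₀ (take k es)

  prefix-suc : (j : Idx) → prefix (suc (toℕ j)) ≡ φAfter j
  prefix-suc j = trans (cong (foldl (step ε) φ₀) (take-suc es j))
                       (foldl-∷ʳ (step ε) φ₀ (edgeAt j) (take (toℕ j) es))

  Δφ≡2w′ : (j : Idx) → Δφ j ≡ w′ j + w′ j
  Δφ≡2w′ j = begin
    Δφ j
      ≡⟨ cong (_- Φ) (totalPot-step ε (φBefore j) (edgeAt j)) ⟩
    (Φ + (w′ j + w′ j)) - Φ
      ≡⟨ solve 2 (λ Φ x → (Φ :+ (x :+ x)) :- Φ := x :+ x) refl Φ (w′ j) ⟩
    w′ j + w′ j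
      ∎
    where
    open ≡-Reasoning
    Φ = totalPot (φBefore j)

  sumP-Δφ : (i : Idx) → sumP i Δφ ≡ sumP i w′ + sumP i w′
  sumP-Δφ i = begin
    sumP i Δφ                         ≡⟨ sumFin≡sum (λ j → if⌊ inP? i j ⌋ (Δφ j)) ⟩
    ∑[ j < length es ] if⌊ inP? i j ⌋ (Δφ j)
      ≡⟨ sum-cong-≗ (λ j → trans (cong if⌊ inP? i j ⌋ (Δφ≡2w′ j)) (if-+ (inP? i j) _ _)) ⟩
    ∑[ j < length es ] (P-w′ j + P-w′ j) ≡⟨ ∑-distrib-+ P-w′ P-w′ ⟩
    sum P-w′ + sum P-w′               ≡⟨ cong₂ _+_ (sumFin≡sum P-w′) (sumFin≡sum P-w′) ⟨
    sumP i w′ + sumP i w′             ∎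
    where
    open ≡-Reasoning
    P-w′ : Idx → ℚ
    P-w′ j = if⌊ inP? i j ⌋ (w′ j)

  module _ (simple : SimpleStream es) (i : Idx) where
    open SimpleStream simple

    endpointPot : Pot n → ℚ
    endpointPot φ = φ (u (edgeAt i)) + φ (v (edgeAt i))

    w′-meeting : Idx → ℚ
    w′-meeting j = if⌊ meets? (edgeAt j) (edgeAt i) ⌋ (w′ j)

    endpointPot-prefix-suc : (j : Idx) → toℕ j <ℕ toℕ i →
      endpointPot (prefix (suc (toℕ j))) ≡ endpointPot (prefix (toℕ j)) + w′-meeting j
    endpointPot-prefix-suc j j<i =
      trans (cong endpointPot (prefix-suc j))
            (step-endpoints ε (φBefore j) (edgeAt j) (edgeAt i) (noLoop j) (noLoop i) (distinct j i j≢i))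
      where
      j≢i : j ≢ i
      j≢i j≡i = <-irrefl (cong toℕ j≡i) j<i

    endpointPot-prefix : ∀ k → k ≤ℕ toℕ i → endpointPot (prefix k) ≡ sumBelow k w′-meeting
    endpointPot-prefix zero    _   = trans (QP.+-identityʳ 0ℚ) (sym (sumBelow-zero w′-meeting))
    endpointPot-prefix (suc k) k<i = extend k<i (endpointPot-prefix k (<⇒≤ k<i))
      where
      extend : ∀ {k} → k <ℕ toℕ i → endpointPot (prefix k) ≡ sumBelow k w′-meeting →
               endpointPot (prefix (suc k)) ≡ sumBelow (suc k) w′-meeting
      extend k<i ih with fromℕ< (<-trans k<i (toℕ<n i)) | toℕ-fromℕ< (<-trans k<i (toℕ<n i))
      ... | j | refl = begin
        endpointPot (prefix (suc (toℕ j)))          ≡⟨ endpointPot-prefix-suc j k<i ⟩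
        endpointPot (prefix (toℕ j)) + w′-meeting j ≡⟨ cong (_+ w′-meeting j) ih ⟩
        sumBelow (toℕ j) w′-meeting + w′-meeting j  ≡⟨ sumBelow-suc w′-meeting j ⟨
        sumBelow (suc (toℕ j)) w′-meeting           ∎
        where open ≡-Reasoning

    sumP-w′ : Pushed i → sumP i w′ ≡ w (edgeAt i)
    sumP-w′ pushed = begin
      sumP i w′                                    ≡⟨ sumFin≡sum (λ j → if⌊ inP? i j ⌋ (w′ j)) ⟩
      ∑[ j < length es ] if⌊ inP? i j ⌋ (w′ j)     ≡⟨ sum-cong-≗ up-to-i ⟩
      sumBelow (suc (toℕ i)) w′-meeting            ≡⟨ sumBelow-suc w′-meeting i ⟩
      sumBelow (toℕ i) w′-meeting + w′-meeting i
        ≡⟨ cong₂ _+_ (sym (endpointPot-prefix (toℕ i) ≤-refl))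
                     (if-yes (meets? (edgeAt i) (edgeAt i)) (w′ i) (inj₁ (inj₁ refl))) ⟩
      Φ + w′ i
        ≡⟨ cong (Φ +_) (wPrime-pushed ε (φBefore i) (edgeAt i) pushed) ⟩
      Φ + (w (edgeAt i) - Φ)
        ≡⟨ solve 2 (λ Φ x → Φ :+ (x :- Φ) := x) refl Φ (w (edgeAt i)) ⟩
      w (edgeAt i)
        ∎
      where
      open ≡-Reasoning
      Φ = endpointPot (φBefore i)
      up-to-i : ∀ j → if⌊ inP? i j ⌋ (w′ j) ≡ if⌊ toℕ j <? suc (toℕ i) ⌋ (w′-meeting j)
      up-to-i j = trans (if-× (j ≤? i) (meets? (edgeAt j) (edgeAt i)) (w′ j))
                        (if-⇔ (j ≤? i) (toℕ j <? suc (toℕ i)) (w′-meeting j) s≤s s≤s⁻¹)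

½*[x+x]≡x : ∀ x → ½ * (x + x) ≡ x
½*[x+x]≡x = solve 1 (λ x → con ½ :* (x :+ x) := x) refl

lemma5 : {n : ℕ} (ε : ℚ) → 0ℚ ≤ ε → (es : List (Edge n)) → SimpleStream es →
         let open Run ε es in
         (i : Idx) → Pushed i →
         (½ * sumP i Δφ ≤ w (edgeAt i)) × (½ * sumP i Δφ ≡ sumP i w′)
lemma5 ε _ es simple i pushed = QP.≤-reflexive (trans half-sum (sumP-w′ ε es simple i pushed)) , half-sum
  where
  open Run ε es
  half-sum : ½ * sumP i Δφ ≡ sumP i w′
  half-sum = trans (cong (½ *_) (sumP-Δφ ε es i)) (½*[x+x]≡x (sumP i w′))
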